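{- Let $G$ be a finite simple connected graph. Then $Mo(G)\neq 1$.
   Context: For a connected graph $G$ and an edge $uv\in E(G)$, let $n_u$ be the number of vertices of $G$ strictly closer (in shortest-path distance) to $u$ than to $v$, and $n_v$ analogously. The Mostar index is $Mo(G)=\sum_{uv\in E(G)}|n_u-n_v|$. -}

module Defs where

open import Data.Nat using (ℕ; zero; suc; _+_; _≤_; _<ᵇ_; ∣_-_∣)
open import Data.Nat.Properties using (_<?_)
open import Data.Fin using (Fin; toℕ)
open import Data.Bool using (Bool; true; false; if_then_else_; _∧_)
open import Data.List using (List; map; filter; length; allFin)
open import Data.Nat.ListAction using (sum)
open import Data.Product using (Σ; _×_; ∃)
open import Relation.Binary.PropositionalEquality using (_≡_)

record Graph (n : ℕ) : Set where
  field
    adj   : Fin n → Fin n → Bool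
    sym   : ∀ u v → adj u v ≡ adj v u
    irrefl : ∀ u → adj u u ≡ false
open Graph public

data Walk {n : ℕ} (G : Graph n) : Fin n → Fin n → ℕ → Set where
  nil  : ∀ u → Walk G u u zero
  cons : ∀ {u w v k} → adj G u w ≡ true → Walk G w v k → Walk G u v (suc k)

Connected : ∀ {n} → Graph n → Set
Connected G = ∀ u v → ∃ λ k → Walk G u v k

IsDistance : ∀ {n} → Graph n → (Fin n → Fin n → ℕ) → Set
IsDistance G d = ∀ u v → Walk G u v (d u v) × (∀ k → Walk G u v k → d u v ≤ k)

closerCount : ∀ {n} → (Fin n → Fin n → ℕ) → Fin n → Fin n → ℕ
closerCount {n} d u v = length (filter (λ w → d w u <? d w v) (allFin n))

Mostar : ∀ {n} → Graph n → (Fin n → Fin n → ℕ) → ℕ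
Mostar {n} G d =
  sum (map (λ u → sum (map (λ v →
      if adj G u v ∧ (toℕ u <ᵇ toℕ v)
      then ∣ closerCount d u v - closerCount d v u ∣
      else 0) (allFin n))) (allFin n))

-- For an edge ab, every vertex w has |d(w,a) − d(w,b)| ≤ 1, so n_a − n_b = D(b) − D(a), where
-- D(x) = Σ_w d(w,x) is the transmission. If Mo(G) = 1, then uv is the only edge along which D
-- changes, and it changes by one, say D(v) = D(u) + 1. Let U = {w | D(w) = D(u)}. Every walk
-- between U and its complement passes through the edge uv, so d(w,v) = d(w,u) + 1 on U and
-- d(w,u) = d(w,v) + 1 off U; summing over w gives |U| = |Uᶜ| + 1. For x ∈ U with δ = d(u,x),
-- comparing D(x) with D(u) vertex by vertex gives D(x) ≥ D(u) + (|Uᶜ| − |U| + 2)δ = D(u) + δ,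
-- hence δ = 0. So U = {u}, forcing Uᶜ = ∅, which contradicts v ∉ U.
{-# OPTIONS --safe #-}
module Submission where

open import Defs hiding (sym)
open import Data.Nat using (ℕ; zero; suc; _+_; _*_; _≤_; _<_; z≤n; s≤s; s≤s⁻¹; _<ᵇ_; ∣_-_∣)
open import Data.Nat.Properties
open import Algebra.Properties.Semiring.Sum +-*-semiring
  using (sum; sum-syntax; ∑-distrib-+; sum-cong-≗; sum-replicate-zero; *-distribʳ-sum)
open import Data.Fin using (Fin; toℕ; zero; suc)
import Data.Fin.Properties as Fin
open import Data.Bool using (true; false; if_then_else_; _∧_)
open import Data.Bool.Properties using (T-≡)
open import Data.List using (List; []; _∷_; map; filter; length; allFin; tabulate)
open import Data.List.Properties using (map-tabulate)
open import Data.Nat.ListAction using () renaming (sum to listSum)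
open import Data.Product using (∃; ∃₂; _×_; _,_; proj₁; proj₂; swap)
open import Data.Sum using (_⊎_; inj₁; inj₂) renaming (swap to ⊎-swap)
open import Data.Empty using (⊥; ⊥-elim)
open import Function using (id; _∘_; case_of_)
open import Function.Bundles using (Equivalence)
open import Relation.Nullary using (¬_; Dec; yes; no; does)
open import Relation.Nullary.Decidable using (¬?)
open import Relation.Unary using (Pred; Decidable)
open import Relation.Binary using (tri<; tri≈; tri>)
open import Relation.Binary.PropositionalEquality

𝟙 : ∀ {p} {P : Set p} → Dec P → ℕ
𝟙 P? = if does P? then 1 else 0

𝟙-yes : ∀ {p} {P : Set p} (P? : Dec P) → P → 𝟙 P? ≡ 1
𝟙-yes (yes _) _ = refl
𝟙-yes (no ¬p) p = ⊥-elim (¬p p)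

𝟙-mono : ∀ {p q} {P : Set p} {Q : Set q} (P? : Dec P) (Q? : Dec Q) → (P → Q) → 𝟙 P? ≤ 𝟙 Q?
𝟙-mono (yes p) (yes _) _   = ≤-refl
𝟙-mono (yes p) (no ¬q) P⇒Q = ⊥-elim (¬q (P⇒Q p))
𝟙-mono (no _)  _       _   = z≤n

listSum-tabulate : ∀ {n} (f : Fin n → ℕ) → listSum (tabulate f) ≡ sum f
listSum-tabulate {zero}  f = refl
listSum-tabulate {suc n} f = cong (f zero +_) (listSum-tabulate (f ∘ suc))

listSum-allFin : ∀ {n} (f : Fin n → ℕ) → listSum (map f (allFin n)) ≡ sum f
listSum-allFin f = trans (cong listSum (map-tabulate id f)) (listSum-tabulate f)

length-filter≡listSum-𝟙 : ∀ {a p} {A : Set a} {P : Pred A p} (P? : Decidable P) (xs : List A) →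
  length (filter P? xs) ≡ listSum (map (λ x → 𝟙 (P? x)) xs)
length-filter≡listSum-𝟙 P? []       = refl
length-filter≡listSum-𝟙 P? (x ∷ xs) with does (P? x)
... | true  = cong suc (length-filter≡listSum-𝟙 P? xs)
... | false = length-filter≡listSum-𝟙 P? xs

length-filter-allFin : ∀ {n p} {P : Pred (Fin n) p} (P? : Decidable P) →
  length (filter P? (allFin n)) ≡ sum (λ i → 𝟙 (P? i))
length-filter-allFin P? =
  trans (length-filter≡listSum-𝟙 P? (allFin _)) (listSum-allFin (λ i → 𝟙 (P? i)))

sum-mono-≤ : ∀ {n} {f g : Fin n → ℕ} → (∀ i → f i ≤ g i) → sum f ≤ sum g
sum-mono-≤ {zero}  f≤g = z≤n
sum-mono-≤ {suc n} f≤g = +-mono-≤ (f≤g zero) (sum-mono-≤ (f≤g ∘ suc))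

sum≡0⇒≡0 : ∀ {n} (f : Fin n → ℕ) → sum f ≡ 0 → ∀ i → f i ≡ 0
sum≡0⇒≡0 f eq zero    = m+n≡0⇒m≡0 (f zero) eq
sum≡0⇒≡0 f eq (suc i) = sum≡0⇒≡0 (f ∘ suc) (m+n≡0⇒n≡0 (f zero) eq) i

sum≡1⇒unique : ∀ {n} (f : Fin n → ℕ) → sum f ≡ 1 →
  ∃ λ i → f i ≡ 1 × (∀ j → f j ≢ 0 → j ≡ i)
sum≡1⇒unique {zero}  f ()
sum≡1⇒unique {suc n} f eq with f zero in f₀
... | zero =
  let i , fi≡1 , unique = sum≡1⇒unique (f ∘ suc) eq in
  suc i , fi≡1 , λ { zero fj≢0 → ⊥-elim (fj≢0 f₀) ; (suc j) fj≢0 → cong suc (unique j fj≢0) }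
... | suc zero =
  zero , f₀ , λ { zero _ → refl
                ; (suc j) fj≢0 → ⊥-elim (fj≢0 (sum≡0⇒≡0 (f ∘ suc) (suc-injective eq) j)) }
... | suc (suc _) = ⊥-elim (1+n≢0 (suc-injective eq))

sum-𝟙-≟ : ∀ {n} (u : Fin n) → sum (λ w → 𝟙 (w Fin.≟ u)) ≡ 1
sum-𝟙-≟ {suc n} zero = cong suc (sum-replicate-zero n)
sum-𝟙-≟ (suc u)      = sum-𝟙-≟ u

𝟙<-+-balance : ∀ {x y} (x<y? : Dec (x < y)) (y<x? : Dec (y < x)) →
  x ≤ suc y → y ≤ suc x → 𝟙 x<y? + x ≡ 𝟙 y<x? + y
𝟙<-+-balance (yes x<y) (yes y<x) _     _     = ⊥-elim (<-asym x<y y<x)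
𝟙<-+-balance (yes x<y) (no _)    _     y≤1+x = ≤-antisym x<y y≤1+x
𝟙<-+-balance (no _)    (yes y<x) x≤1+y _     = ≤-antisym x≤1+y y<x
𝟙<-+-balance (no x≮y)  (no y≮x)  _     _     = ≤-antisym (≮⇒≥ y≮x) (≮⇒≥ x≮y)

+-balance-∣-∣≡1 : ∀ p q {x y} → ∣ p - q ∣ ≡ 1 → p + x ≡ q + y → y ≡ suc x ⊎ x ≡ suc y
+-balance-∣-∣≡1 zero          (suc zero) _   eq = inj₂ eq
+-balance-∣-∣≡1 (suc zero)    zero       _   eq = inj₁ (sym eq)
+-balance-∣-∣≡1 (suc p)       (suc q)    gap eq = +-balance-∣-∣≡1 p q gap (suc-injective eq)
+-balance-∣-∣≡1 zero          zero          ()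
+-balance-∣-∣≡1 zero          (suc (suc _)) ()
+-balance-∣-∣≡1 (suc (suc _)) zero          ()

<ᵇ-orientation : ∀ {n} {a b : Fin n} → a ≢ b → (toℕ a <ᵇ toℕ b) ≡ true ⊎ (toℕ b <ᵇ toℕ a) ≡ true
<ᵇ-orientation {a = a} {b} a≢b with Fin.<-cmp a b
... | tri< a<b _ _ = inj₁ (Equivalence.to T-≡ (<⇒<ᵇ a<b))
... | tri≈ _ a≡b _ = ⊥-elim (a≢b a≡b)
... | tri> _ _ b<a = inj₂ (Equivalence.to T-≡ (<⇒<ᵇ b<a))

if-∧-≢0 : ∀ x y {m} → (if x ∧ y then m else 0) ≢ 0 → x ≡ true × y ≡ true
if-∧-≢0 true  true  _   = refl , refl
if-∧-≢0 true  false m≢0 = ⊥-elim (m≢0 refl)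
if-∧-≢0 false _     m≢0 = ⊥-elim (m≢0 refl)

if-∧-true : ∀ {x y} {m k : ℕ} → x ≡ true → y ≡ true → (if x ∧ y then m else k) ≡ m
if-∧-true refl refl = refl

module Distances {n : ℕ} (G : Graph n) (d : Fin n → Fin n → ℕ) (isDist : IsDistance G d) where

  adj-sym : ∀ {a b} → adj G a b ≡ true → adj G b a ≡ true
  adj-sym {a} {b} e = trans (Graph.sym G b a) e

  adj⇒≢ : ∀ {a b} → adj G a b ≡ true → a ≢ b
  adj⇒≢ {a} e refl = case trans (sym e) (irrefl G a) of λ ()

  _∷ʳ_ : ∀ {u w v k} → Walk G u w k → adj G w v ≡ true → Walk G u v (suc k)
  nil _     ∷ʳ e = cons e (nil _)
  cons e′ p ∷ʳ e = cons e′ (p ∷ʳ e)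

  reverse : ∀ {u v k} → Walk G u v k → Walk G v u k
  reverse (nil u)    = nil u
  reverse (cons e p) = reverse p ∷ʳ adj-sym e

  _++_ : ∀ {u v w k m} → Walk G u v k → Walk G v w m → Walk G u w (k + m)
  nil _    ++ q = q
  cons e p ++ q = cons e (p ++ q)

  geodesic : ∀ u v → Walk G u v (d u v)
  geodesic u v = proj₁ (isDist u v)

  d-minimal : ∀ {u v k} → Walk G u v k → d u v ≤ k
  d-minimal {u} {v} {k} = proj₂ (isDist u v) k

  d-refl : ∀ u → d u u ≡ 0
  d-refl u = n≤0⇒n≡0 (d-minimal (nil u))

  d≡0⇒≡ : ∀ {u v} → d u v ≡ 0 → u ≡ v
  d≡0⇒≡ {u} {v} eq = walk₀⇒≡ (subst (Walk G u v) eq (geodesic u v))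
    where
    walk₀⇒≡ : Walk G u v 0 → u ≡ v
    walk₀⇒≡ (nil _) = refl

  d-sym : ∀ u v → d u v ≡ d v u
  d-sym u v = ≤-antisym (d-minimal (reverse (geodesic v u))) (d-minimal (reverse (geodesic u v)))

  d-triangle : ∀ u v w → d u w ≤ d u v + d v w
  d-triangle u v w = d-minimal (geodesic u v ++ geodesic v w)

  d-adj-≤ : ∀ {a b} → adj G a b ≡ true → ∀ w → d w b ≤ suc (d w a)
  d-adj-≤ {a} e w = d-minimal (geodesic w a ∷ʳ e)

  adj⇒d≡1 : ∀ {a b} → adj G a b ≡ true → d a b ≡ 1
  adj⇒d≡1 {a} {b} e with d a b in eq | d-minimal (cons e (nil b))
  ... | zero        | _       = ⊥-elim (adj⇒≢ e (d≡0⇒≡ eq))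
  ... | suc zero    | _       = refl
  ... | suc (suc _) | s≤s ()

  SoleCrossing : (Fin n → ℕ) → Fin n → Fin n → Set
  SoleCrossing f u v = ∀ {a b} → adj G a b ≡ true → f a ≢ f b → (a ≡ u × b ≡ v) ⊎ (a ≡ v × b ≡ u)

  SoleCrossing-swap : ∀ {f u v} → SoleCrossing f u v → SoleCrossing f v u
  SoleCrossing-swap sole e fa≢fb = ⊎-swap (sole e fa≢fb)

  module _ {f : Fin n → ℕ} {u v : Fin n} (sole : SoleCrossing f u v) where

    walk-through-crossing : ∀ {w z k} → Walk G w z k → f w ≢ f z → d w u + d u z ≤ k
    walk-through-crossing (nil _) fw≢fz = ⊥-elim (fw≢fz refl)
    walk-through-crossing {w} {z} (cons {w = w₁} e p) fw≢fz with f w ≟ f w₁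
    ... | yes fw≡fw₁ =
      ≤-trans (+-monoˡ-≤ (d u z) (d-minimal (cons e (geodesic w₁ u))))
              (s≤s (walk-through-crossing p (fw≢fz ∘ trans fw≡fw₁)))
    ... | no fw≢fw₁ with sole e fw≢fw₁
    ...   | inj₁ (refl , refl) rewrite d-refl u = d-minimal (cons e p)
    ...   | inj₂ (refl , refl) = +-mono-≤ (d-minimal (cons e (nil u))) (d-minimal p)

    geodesic-through-crossing : ∀ {w z} → f w ≢ f z → d w u + d u z ≤ d w z
    geodesic-through-crossing {w} {z} = walk-through-crossing (geodesic w z)

    d-across-crossing : adj G u v ≡ true → ∀ {w} → f w ≢ f v → d w v ≡ d w u + 1
    d-across-crossing e {w} fw≢fv = ≤-antisym
      (d-minimal (geodesic w u ++ cons e (nil v)))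
      (subst (λ t → d w u + t ≤ d w v) (adj⇒d≡1 e) (geodesic-through-crossing fw≢fv))

module Transmission {n : ℕ} (G : Graph n) (d : Fin n → Fin n → ℕ) (isDist : IsDistance G d) where

  open Distances G d isDist public

  transmission : Fin n → ℕ
  transmission x = ∑[ w < n ] d w x

  closerCount-+-transmission : ∀ {a b} → adj G a b ≡ true →
    closerCount d a b + transmission a ≡ closerCount d b a + transmission b
  closerCount-+-transmission {a} {b} e = begin
    closerCount d a b + transmission a
      ≡⟨ cong (_+ transmission a) (length-filter-allFin (λ w → d w a <? d w b)) ⟩
    ∑[ w < n ] 𝟙 (d w a <? d w b) + ∑[ w < n ] d w a
      ≡⟨ ∑-distrib-+ (λ w → 𝟙 (d w a <? d w b)) (λ w → d w a) ⟨
    ∑[ w < n ] (𝟙 (d w a <? d w b) + d w a)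
      ≡⟨ sum-cong-≗ (λ w → 𝟙<-+-balance (d w a <? d w b) (d w b <? d w a)
                             (d-adj-≤ (adj-sym e) w) (d-adj-≤ e w)) ⟩
    ∑[ w < n ] (𝟙 (d w b <? d w a) + d w b)
      ≡⟨ ∑-distrib-+ (λ w → 𝟙 (d w b <? d w a)) (λ w → d w b) ⟩
    ∑[ w < n ] 𝟙 (d w b <? d w a) + ∑[ w < n ] d w b
      ≡⟨ cong (_+ transmission b) (length-filter-allFin (λ w → d w b <? d w a)) ⟨
    closerCount d b a + transmission b ∎
    where open ≡-Reasoning

  module _ {u v : Fin n} (e : adj G u v ≡ true) (Dv≡1+Du : transmission v ≡ suc (transmission u))
           (sole : SoleCrossing transmission u v) where

    private
      D = transmission

    inU? : ∀ w → Dec (D w ≡ D u)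
    inU? w = D w ≟ D u

    sizeU sizeUᶜ : ℕ
    sizeU  = ∑[ w < n ] 𝟙 (inU? w)
    sizeUᶜ = ∑[ w < n ] 𝟙 (¬? (inU? w))

    d-to-v : ∀ w → d w v + 𝟙 (¬? (inU? w)) ≡ d w u + 𝟙 (inU? w)
    d-to-v w = by-side (inU? w)
      where
      by-side : (w∈U? : Dec (D w ≡ D u)) → d w v + 𝟙 (¬? w∈U?) ≡ d w u + 𝟙 w∈U?
      by-side (yes Dw≡Du) = trans (+-identityʳ (d w v)) (d-across-crossing sole e Dw≢Dv)
        where
        Dw≢Dv : D w ≢ D v
        Dw≢Dv Dw≡Dv = 1+n≢n (trans (sym Dv≡1+Du) (trans (sym Dw≡Dv) Dw≡Du))
      by-side (no Dw≢Du) = sym (trans (+-identityʳ (d w u))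
                                      (d-across-crossing (SoleCrossing-swap sole) (adj-sym e) Dw≢Du))

    sizeU≡1+sizeUᶜ : sizeU ≡ suc sizeUᶜ
    sizeU≡1+sizeUᶜ = +-cancelˡ-≡ (D u) _ _ (begin
      D u + sizeU                           ≡⟨ ∑-distrib-+ (λ w → d w u) (λ w → 𝟙 (inU? w)) ⟨
      ∑[ w < n ] (d w u + 𝟙 (inU? w))       ≡⟨ sum-cong-≗ d-to-v ⟨
      ∑[ w < n ] (d w v + 𝟙 (¬? (inU? w)))  ≡⟨ ∑-distrib-+ (λ w → d w v) (λ w → 𝟙 (¬? (inU? w))) ⟩
      D v + sizeUᶜ                          ≡⟨ cong (_+ sizeUᶜ) Dv≡1+Du ⟩
      suc (D u) + sizeUᶜ                    ≡⟨ +-suc (D u) sizeUᶜ ⟨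
      D u + suc sizeUᶜ                      ∎)
      where open ≡-Reasoning

    module _ {x : Fin n} (Dx≡Du : D x ≡ D u) where

      private
        δ = d u x

      -- u is weighted twice: d(u,x) = d(u,u) + δ, whereas inside U only d(w,x) ≥ d(w,u) − δ holds.
      weight : Fin n → ℕ
      weight w = 𝟙 (w Fin.≟ u) + 𝟙 (w Fin.≟ u) + 𝟙 (¬? (inU? w))

      weighted-≤ : ∀ w → d w u + weight w * δ ≤ d w x + 𝟙 (inU? w) * δ
      weighted-≤ w = by-cases w (w Fin.≟ u) (inU? w)
        where
        by-cases : ∀ w (w≡u? : Dec (w ≡ u)) (w∈U? : Dec (D w ≡ D u)) →
          d w u + (𝟙 w≡u? + 𝟙 w≡u? + 𝟙 (¬? w∈U?)) * δ ≤ d w x + 𝟙 w∈U? * δ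
        by-cases w (yes refl) (yes _)      rewrite d-refl u = ≤-refl
        by-cases w (yes refl) (no Du≢Du)   = ⊥-elim (Du≢Du refl)
        by-cases w (no _)     (yes Dw≡Du)  =
          subst₂ _≤_ (sym (+-identityʳ (d w u))) (cong (d w x +_) (sym (*-identityˡ δ)))
                 (subst (λ t → d w u ≤ d w x + t) (d-sym x u) (d-triangle w x u))
        by-cases w (no _)     (no Dw≢Du)   =
          subst₂ _≤_ (cong (d w u +_) (sym (*-identityˡ δ))) (sym (+-identityʳ (d w x)))
                 (geodesic-through-crossing sole (λ Dw≡Dx → Dw≢Du (trans Dw≡Dx Dx≡Du)))

      weight-sum : ∑[ w < n ] weight w ≡ 2 + sizeUᶜ
      weight-sum = begin
        ∑[ w < n ] weight w
          ≡⟨ ∑-distrib-+ (λ w → 𝟙 (w Fin.≟ u) + 𝟙 (w Fin.≟ u)) (λ w → 𝟙 (¬? (inU? w))) ⟩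
        ∑[ w < n ] (𝟙 (w Fin.≟ u) + 𝟙 (w Fin.≟ u)) + sizeUᶜ
          ≡⟨ cong (_+ sizeUᶜ) (∑-distrib-+ (λ w → 𝟙 (w Fin.≟ u)) (λ w → 𝟙 (w Fin.≟ u))) ⟩
        ∑[ w < n ] 𝟙 (w Fin.≟ u) + ∑[ w < n ] 𝟙 (w Fin.≟ u) + sizeUᶜ
          ≡⟨ cong (λ k → k + k + sizeUᶜ) (sum-𝟙-≟ u) ⟩
        2 + sizeUᶜ ∎
        where open ≡-Reasoning

      δ≡0 : d u x ≡ 0
      δ≡0 = n≤0⇒n≡0 (+-cancelʳ-≤ (suc sizeUᶜ * δ) δ 0 (+-cancelˡ-≤ (D u) _ _ (begin
        D u + (2 + sizeUᶜ) * δ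
          ≡⟨ cong (λ k → D u + k * δ) weight-sum ⟨
        D u + (∑[ w < n ] weight w) * δ
          ≡⟨ cong (D u +_) (*-distribʳ-sum δ weight) ⟩
        D u + ∑[ w < n ] (weight w * δ)
          ≡⟨ ∑-distrib-+ (λ w → d w u) (λ w → weight w * δ) ⟨
        ∑[ w < n ] (d w u + weight w * δ)
          ≤⟨ sum-mono-≤ weighted-≤ ⟩
        ∑[ w < n ] (d w x + 𝟙 (inU? w) * δ)
          ≡⟨ ∑-distrib-+ (λ w → d w x) (λ w → 𝟙 (inU? w) * δ) ⟩
        D x + ∑[ w < n ] (𝟙 (inU? w) * δ)
          ≡⟨ cong₂ _+_ Dx≡Du (sym (*-distribʳ-sum δ (λ w → 𝟙 (inU? w)))) ⟩
        D u + sizeU * δ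
          ≡⟨ cong (λ k → D u + k * δ) sizeU≡1+sizeUᶜ ⟩
        D u + suc sizeUᶜ * δ ∎)))
        where open ≤-Reasoning

    inU⇒≡u : ∀ {x} → D x ≡ D u → x ≡ u
    inU⇒≡u Dx≡Du = sym (d≡0⇒≡ (δ≡0 Dx≡Du))

    sizeUᶜ≡0 : sizeUᶜ ≡ 0
    sizeUᶜ≡0 = n≤0⇒n≡0 (s≤s⁻¹ (begin
      suc sizeUᶜ             ≡⟨ sizeU≡1+sizeUᶜ ⟨
      sizeU                  ≤⟨ sum-mono-≤ (λ w → 𝟙-mono (inU? w) (w Fin.≟ u) inU⇒≡u) ⟩
      ∑[ w < n ] 𝟙 (w Fin.≟ u) ≡⟨ sum-𝟙-≟ u ⟩
      1                      ∎))
      where open ≤-Reasoning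

    sole-crossing-gap-one⇒⊥ : ⊥
    sole-crossing-gap-one⇒⊥ = 1+n≢0 (trans (sym (𝟙-yes (¬? (inU? v)) Dv≢Du)) (sum≡0⇒≡0 _ sizeUᶜ≡0 v))
      where
      Dv≢Du : D v ≢ D u
      Dv≢Du Dv≡Du = 1+n≢n (trans (sym Dv≡1+Du) Dv≡Du)

  transmission-gap : ∀ {u v} → adj G u v ≡ true → ∣ closerCount d u v - closerCount d v u ∣ ≡ 1 →
    transmission v ≡ suc (transmission u) ⊎ transmission u ≡ suc (transmission v)
  transmission-gap e gap = +-balance-∣-∣≡1 _ _ gap (closerCount-+-transmission e)

  ∣closerCount∣≡0⇒transmission-≡ : ∀ {a b} → adj G a b ≡ true →
    ∣ closerCount d a b - closerCount d b a ∣ ≡ 0 → transmission a ≡ transmission b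
  ∣closerCount∣≡0⇒transmission-≡ {a} {b} e ∣n-n∣≡0 = +-cancelˡ-≡ (closerCount d a b) _ _
    (trans (closerCount-+-transmission e) (cong (_+ transmission b) (sym (∣m-n∣≡0⇒m≡n ∣n-n∣≡0))))

  mostarTerm : Fin n → Fin n → ℕ
  mostarTerm a b =
    if adj G a b ∧ (toℕ a <ᵇ toℕ b) then ∣ closerCount d a b - closerCount d b a ∣ else 0

  Mostar≡∑∑mostarTerm : Mostar G d ≡ ∑[ a < n ] ∑[ b < n ] mostarTerm a b
  Mostar≡∑∑mostarTerm =
    trans (listSum-allFin (λ a → listSum (map (mostarTerm a) (allFin n))))
          (sum-cong-≗ (λ a → listSum-allFin (mostarTerm a)))

  Mostar≡1⇒sole-crossing : Mostar G d ≡ 1 → ∃₂ λ u v →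
    adj G u v ≡ true × ∣ closerCount d u v - closerCount d v u ∣ ≡ 1 × SoleCrossing transmission u v
  Mostar≡1⇒sole-crossing Mo≡1
    with sum≡1⇒unique _ (trans (sym Mostar≡∑∑mostarTerm) Mo≡1)
  ... | u , row≡1 , onlyRow with sum≡1⇒unique (mostarTerm u) row≡1
  ... | v , term≡1 , onlyColumn = u , v , e , trans (sym (if-∧-true e u<v)) term≡1 , sole
    where
    edge : adj G u v ≡ true × (toℕ u <ᵇ toℕ v) ≡ true
    edge = if-∧-≢0 (adj G u v) (toℕ u <ᵇ toℕ v) (λ term≡0 → 1+n≢0 (trans (sym term≡1) term≡0))
    e = proj₁ edge
    u<v = proj₂ edge

    nonzero⇒uv : ∀ {a b} → mostarTerm a b ≢ 0 → a ≡ u × b ≡ v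
    nonzero⇒uv {a} {b} term≢0 with onlyRow a (λ row≡0 → term≢0 (sum≡0⇒≡0 _ row≡0 b))
    ... | refl = refl , onlyColumn b term≢0

    crossing⇒nonzero : ∀ {a b} → adj G a b ≡ true → (toℕ a <ᵇ toℕ b) ≡ true →
      transmission a ≢ transmission b → mostarTerm a b ≢ 0
    crossing⇒nonzero e′ a<b Da≢Db term≡0 =
      Da≢Db (∣closerCount∣≡0⇒transmission-≡ e′ (trans (sym (if-∧-true e′ a<b)) term≡0))

    sole : SoleCrossing transmission u v
    sole e′ Da≢Db with <ᵇ-orientation (adj⇒≢ e′)
    ... | inj₁ a<b = inj₁ (nonzero⇒uv (crossing⇒nonzero e′ a<b Da≢Db))
    ... | inj₂ b<a = inj₂ (swap (nonzero⇒uv (crossing⇒nonzero (adj-sym e′) b<a (Da≢Db ∘ sym))))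

mainTheorem6 : (n : ℕ) (G : Graph n) → Connected G →
    (d : Fin n → Fin n → ℕ) → IsDistance G d → ¬ (Mostar G d ≡ 1)
mainTheorem6 n G _ d isDist Mo≡1 =
  let open Transmission G d isDist
      (u , v , e , gap , sole) = Mostar≡1⇒sole-crossing Mo≡1
  in case transmission-gap e gap of λ where
       (inj₁ Dv≡1+Du) → sole-crossing-gap-one⇒⊥ e Dv≡1+Du sole
       (inj₂ Du≡1+Dv) → sole-crossing-gap-one⇒⊥ (adj-sym e) Du≡1+Dv (SoleCrossing-swap sole)
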